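{- Fix a positive integer $K$, and let $f_1,\dots,f_K$ be the functions defined in the context. For every $t\in\{2,\dots,K\}$ and every non-negative integer $b$, $f_t(1,0,\dots,0;b,0,\dots,0)=f_t(0,0,\dots,0;b+1,0,\dots,0)$.
   Context: Let $m_t=(2t-1)!$. For $t\in\{1,\dots,K\}$, $f_t$ is a function of $r_{K-t+1},\dots,r_K\in\{0,1\}$ and non-negative integers $b_{K-t+1},\dots,b_K$, written $f_t(r_{K-t+1},\dots,r_K;b_{K-t+1},\dots,b_K)$. Put $\hat b_i=\min\{b_i,2(K-i)\}$; each $f_t$ depends on the $b_i$ only through $\hat b_i$. Define $f_1(r_K;b_K)=r_K$. For $t\ge2$, given the arguments, let $\delta_{t-1}=m_{t-1}-f_{t-1}(r_{K-t+2},\dots,r_K;\hat b_{K-t+2},\dots,\hat b_K)$, $d_t=2(t-1)-\hat b_{K-t+1}$, $s_t=1-r_{K-t+1}$, $a_t=2m_{t-1}s_t+\delta_{t-1}(d_t-1)$, and $f_t(r_{K-t+1},\dots,r_K;b_{K-t+1},\dots,b_K)=m_t-a_t d_t$. -}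

module Defs where

open import Data.Nat using (ℕ; zero; suc; _∸_; _⊓_; _!) renaming (_*_ to _*ℕ_)
open import Data.Bool using (Bool; true; false)
open import Data.Integer using (ℤ; +_; _-_; _*_; _+_)
open import Data.Vec using (Vec; []; _∷_)

m : ℕ → ℤ
m t = + ((2 *ℕ t ∸ 1) !)

bit : Bool → ℤ
bit true  = + 1
bit false = + 0

-- f t rs bs  is  f_t(r_{K-t+1},…,r_K ; b_{K-t+1},…,b_K):
-- the vectors have length t, position 0 holding index K-t+1.
-- The cap 2(K-i) for i = K-t+1 equals 2(t-1), so f_t does not depend on K otherwise.
-- The t = 0 clause is junk (f_t is only defined for t ≥ 1) and is never used.
f : (t : ℕ) → Vec Bool t → Vec ℕ t → ℤ
f zero [] [] = + 0
f (suc zero) (r ∷ []) (b ∷ []) = bit r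
f (suc (suc n)) (r ∷ rs) (b ∷ bs) = m (suc (suc n)) - a * d
  where
    -- here t = n+2, so 2(t-1) = 2(n+1)
    bh : ℕ
    bh = b ⊓ (2 *ℕ suc n)
    δ : ℤ
    δ = m (suc n) - f (suc n) rs bs
    d : ℤ
    d = + (2 *ℕ suc n) - + bh
    s : ℤ
    s = + 1 - bit r
    a : ℤ
    a = (+ 2) * m (suc n) * s + δ * (d - + 1)

module Submission where

open import Defs
open import Data.Nat using (ℕ; suc; _≤_)
open import Data.Bool using (true; false)
open import Data.Vec using (_∷_; replicate)
open import Relation.Binary.PropositionalEquality using (_≡_)

open import Data.Bool using (Bool)
open import Data.Nat using (zero; _!; _⊓_; _<_; _<?_) renaming (_*_ to _*ℕ_; _∸_ to _∸ℕ_)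
import Data.Nat.Properties as ℕP
open import Data.Integer using (ℤ; +_; _-_; _*_; _+_)
import Data.Integer.Properties as ℤP
open import Data.Integer.Tactic.RingSolver using (solve-∀)
open import Relation.Binary.PropositionalEquality using (refl; cong; sym; trans; module ≡-Reasoning)
open import Relation.Nullary using (Dec; yes; no)

-- Write t = k+2, D = 2(t-1) and M = m_{t-1}.  On inputs that
-- vanish beyond the first position the recursive call is f_{t-1}(0,…,0;0,…,0),
-- which is 0 for every t-1 ≥ 1 because m_{j+1} = (2j+1)(2j)·m_j; hence δ = M and
--   f_t(r,0,…;b,0,…) = m_t - (2M(1-r) + M(d-1))·d,   d = D - min(b,D).
-- Raising b by one lowers d by one while b < D, and keeps d = 0 once b ≥ D.
-- Flipping r from 1 to 0 adds 2M to the factor a, and the identity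
--   M((d'+1)-1)·(d'+1) = (2M + M(d'-1))·d'
-- shows this compensates exactly for d dropping to d' = d-1; when d = 0 both
-- sides equal m_t.

m-step : ∀ j → m (suc (suc j)) ≡ (+ (2 *ℕ suc j) + + 1) * + (2 *ℕ suc j) * m (suc j)
m-step j = begin
  + ((2 *ℕ suc (suc j) ∸ℕ 1) !)
    ≡⟨ cong (λ x → + ((x ∸ℕ 1) !)) (ℕP.*-distribˡ-+ 2 1 (suc j)) ⟩
  + (suc D *ℕ (D *ℕ (D ∸ℕ 1) !))
    ≡⟨ ℤP.pos-* (suc D) (D *ℕ (D ∸ℕ 1) !) ⟩
  + suc D * + (D *ℕ (D ∸ℕ 1) !)
    ≡⟨ cong (+ suc D *_) (ℤP.pos-* D ((D ∸ℕ 1) !)) ⟩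
  + suc D * (+ D * m (suc j))
    ≡⟨ reassociate (+ D) (m (suc j)) ⟩
  (+ D + + 1) * + D * m (suc j) ∎
  where
  open ≡-Reasoning
  D : ℕ
  D = 2 *ℕ suc j
  reassociate : ∀ x y → (+ 1 + x) * (x * y) ≡ (x + + 1) * x * y
  reassociate = solve-∀

-- f_{j+1} vanishes on all-zero inputs: with r = 0 and b = 0 the recursion gives
-- f_{j+2} = m_{j+2} - (2M + M(D-1))·D = m_{j+2} - (D+1)·D·M = 0 by m-step.
f-zeros : ∀ j → f (suc j) (replicate (suc j) false) (replicate (suc j) 0) ≡ + 0
f-zeros zero = refl
f-zeros (suc j) rewrite f-zeros j | m-step j = cancel (m (suc j)) (+ (2 *ℕ suc j))
  where
  cancel : ∀ M D → (D + + 1) * D * M - ((+ 2) * M * (+ 1 - + 0) + (M - + 0) * ((D - + 0) - + 1)) * (D - + 0) ≡ + 0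
  cancel = solve-∀

deficit : ℕ → ℕ → ℤ
deficit D b = + D - + (b ⊓ D)

deficit-below-cap : ∀ D b → b < D → deficit D b ≡ deficit D (suc b) + + 1
deficit-below-cap D b b<D = begin
  + D - + (b ⊓ D)         ≡⟨ cong (λ x → + D - + x) (ℕP.m≤n⇒m⊓n≡m (ℕP.<⇒≤ b<D)) ⟩
  + D - + b               ≡⟨ shift (+ D) (+ b) ⟩
  (+ D - + suc b) + + 1   ≡⟨ cong (λ x → (+ D - + x) + + 1) (sym (ℕP.m≤n⇒m⊓n≡m b<D)) ⟩
  + D - + (suc b ⊓ D) + + 1 ∎
  where
  open ≡-Reasoning
  shift : ∀ x y → x - y ≡ (x - (+ 1 + y)) + + 1
  shift = solve-∀

deficit-above-cap : ∀ D b → D ≤ b → deficit D b ≡ + 0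
deficit-above-cap D b D≤b =
  trans (cong (λ x → + D - + x) (ℕP.m≥n⇒m⊓n≡n D≤b)) (ℤP.+-inverseʳ (+ D))

leading : ℕ → Bool → ℤ → ℤ
leading j r d = m (suc (suc j)) - ((+ 2) * M * (+ 1 - bit r) + M * (d - + 1)) * d
  where
  M : ℤ
  M = m (suc j)

-- Closed form of f_{j+2} on inputs vanishing beyond the first position:
-- the recursive call is zero (f-zeros), so δ = m_{j+1}.
f-leading : ∀ j r b →
  f (suc (suc j)) (r ∷ replicate (suc j) false) (b ∷ replicate (suc j) 0)
    ≡ leading j r (deficit (2 *ℕ suc j) b)
f-leading j r b rewrite f-zeros j =
  cong (λ δ → m (suc (suc j)) - ((+ 2) * m (suc j) * (+ 1 - bit r) + δ * (d - + 1)) * d)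
       (ℤP.+-identityʳ (m (suc j)))
  where
  d : ℤ
  d = deficit (2 *ℕ suc j) b

leading-exchange : ∀ j d → leading j true (d + + 1) ≡ leading j false d
leading-exchange j d = exchange (m (suc (suc j))) (m (suc j)) d
  where
  exchange : ∀ c M d → c - ((+ 2) * M * (+ 1 - + 1) + M * ((d + + 1) - + 1)) * (d + + 1)
                     ≡ c - ((+ 2) * M * (+ 1 - + 0) + M * (d - + 1)) * d
  exchange = solve-∀

leading-saturated : ∀ j → leading j true (+ 0) ≡ leading j false (+ 0)
leading-saturated j = annihilate (m (suc (suc j))) (m (suc j))
  where
  annihilate : ∀ c M → c - ((+ 2) * M * (+ 1 - + 1) + M * (+ 0 - + 1)) * + 0
                     ≡ c - ((+ 2) * M * (+ 1 - + 0) + M * (+ 0 - + 1)) * + 0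
  annihilate = solve-∀

-- Main result: f_t(1,0,…,0; b,0,…,0) = f_t(0,0,…,0; b+1,0,…,0) for t = k+2.
-- The cap 2(K-i) at the first position is 2(t-1), independent of K, so only
-- 1 ≤ n (i.e. t ≥ 2) is used; it is discharged by matching n = suc k.
lemma3p7 : ∀ (K : ℕ) → 1 ≤ K → ∀ (n : ℕ) → 1 ≤ n → suc n ≤ K → ∀ (b : ℕ) →
    f (suc n) (true ∷ replicate n false) (b ∷ replicate n 0)
      ≡ f (suc n) (false ∷ replicate n false) (suc b ∷ replicate n 0)
lemma3p7 _ _ (suc k) _ _ b = begin
  f (suc (suc k)) (true ∷ replicate (suc k) false) (b ∷ replicate (suc k) 0)
    ≡⟨ f-leading k true b ⟩
  leading k true (deficit D b)
    ≡⟨ exchange-at-cap (b <? D) ⟩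
  leading k false (deficit D (suc b))
    ≡⟨ sym (f-leading k false (suc b)) ⟩
  f (suc (suc k)) (false ∷ replicate (suc k) false) (suc b ∷ replicate (suc k) 0) ∎
  where
  open ≡-Reasoning
  D : ℕ
  D = 2 *ℕ suc k
  exchange-at-cap : Dec (b < D) → leading k true (deficit D b) ≡ leading k false (deficit D (suc b))
  exchange-at-cap (yes b<D) = trans (cong (leading k true) (deficit-below-cap D b b<D))
                                    (leading-exchange k (deficit D (suc b)))
  exchange-at-cap (no b≮D) = begin
    leading k true (deficit D b)       ≡⟨ cong (leading k true) (deficit-above-cap D b D≤b) ⟩
    leading k true (+ 0)               ≡⟨ leading-saturated k ⟩
    leading k false (+ 0)              ≡⟨ cong (leading k false) (sym (deficit-above-cap D (suc b) (ℕP.m≤n⇒m≤1+n D≤b))) ⟩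
    leading k false (deficit D (suc b)) ∎
    where
    D≤b : D ≤ b
    D≤b = ℕP.≮⇒≥ b≮D
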